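{- Let $n \ge 4$ be an integer and let $f(n)$ be as defined in the context. Then $$f(n) \le \left\lfloor \frac{n}{4} \right\rfloor + d,$$ where $d = 1, 2, 2, 4$ according as $n \equiv 0, 1, 2, 3 \pmod 4$, respectively.
   Context: For a positive integer $n$, the Farey sequence of order $n$ is the increasing sequence $\frac{a_1}{b_1} < \frac{a_2}{b_2} < \cdots$ of all reduced fractions $\frac{a}{b}$ with $0 \le \frac{a}{b} \le 1$ and $1 \le b \le n$ (so it begins with $\frac{0}{1}$ and ends with $\frac{1}{1}$). Two fractions $\frac{a}{b}$ and $\frac{a'}{b'}$ (written in lowest terms) are called similarly ordered if $(a'-a)(b'-b) \ge 0$. For $n \ge 4$, $f(n)$ denotes the largest integer such that $\frac{a_k}{b_k}$ and $\frac{a_l}{b_l}$ are similarly ordered for all indices $k, l$ of the Farey sequence of order $n$ with $|l-k| \le f(n)$. -}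

module Defs where

open import Data.Nat using (ℕ; zero; suc; _+_; _*_; _≤_; _<_; ∣_-_∣; _%_; _/_)
open import Data.Nat.Coprimality using (Coprime)
open import Data.Integer as ℤ using (ℤ; +_)
open import Data.Product using (_×_; _,_)
open import Data.List using (List; length; lookup)
open import Data.List.Membership.Propositional using (_∈_)
open import Data.List.Relation.Unary.Linked using (Linked)
open import Data.Fin using (Fin; toℕ)
open import Function.Bundles using (_⇔_)

-- A fraction a/b is represented by the pair (a , b).
Frac : Set
Frac = ℕ × ℕ

-- a/b < a'/b'  (for positive denominators)
_<F_ : Frac → Frac → Set
(a , b) <F (a' , b') = a * b' < a' * b

InFarey : ℕ → Frac → Set
InFarey n (a , b) = Coprime a b × a ≤ b × 1 ≤ b × b ≤ n

IsFareySeq : ℕ → List Frac → Set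
IsFareySeq n F = Linked _<F_ F × (∀ x → (x ∈ F ⇔ InFarey n x))

SimilarlyOrdered : Frac → Frac → Set
SimilarlyOrdered (a , b) (a' , b') =
  + 0 ℤ.≤ ((+ a' ℤ.- + a) ℤ.* (+ b' ℤ.- + b))

GoodUpTo : List Frac → ℕ → Set
GoodUpTo F m = ∀ (k l : Fin (length F)) → ∣ toℕ l - toℕ k ∣ ≤ m →
  SimilarlyOrdered (lookup F k) (lookup F l)

-- m is the largest integer with GoodUpTo F m  (i.e. m = f(n))
IsLargestGood : List Frac → ℕ → Set
IsLargestGood F m = GoodUpTo F m × (∀ m' → GoodUpTo F m' → m' ≤ m)

dOf : ℕ → ℕ
dOf n with n % 4
... | 0 = 1
... | 1 = 2
... | 2 = 2
... | _ = 4

-- A pair a/(b+1) < (a+1)/b of the Farey sequence of order n has (Δa)(Δb) = -1, so it is not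
-- similarly ordered and f(n) is less than its distance in the sequence. To count the
-- fractions in between, join the pair by a chain of neighbours p/q < p'/q' with
-- p'q - pq' = 1 and q + q' > n: by Cramer's rule every fraction strictly between such
-- neighbours has denominator at least q + q', so only the interior of the chain lies between
-- the ends. For n = 4k take (2k-1)/4k < 2k/(4k-1) with interior k/(2k+1), ..., (2k-1)/(4k-1),
-- 1/2; for n = 4k + r, 1 ≤ r ≤ 3, take 2k/(4k+1) < (2k+1)/4k with interior (2k+1)/(4k+3)
-- (only if r = 3), 1/2 and (m+1)/(2m+1) for m from 2k + ⌊r/3⌋ down to k. These have k + 1,
-- k + 2, k + 2 and k + 4 elements. The last link (k+1)/(2k+1), (2k+1)/4k needs 6k + 1 > n,
-- which fails only for n = 7; there 4/7 < 5/6 with five fractions in between is used.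

module Submission where

open import Defs
open import Data.Nat using (ℕ; zero; suc; _+_; _*_; _∸_; _≤_; _<_; _/_; _%_; ∣_-_∣; s≤s; s≤s⁻¹; z≤n; z<s; NonZero; >-nonZero)
open import Data.Nat.Properties
open import Data.Nat.DivMod using (m≡m%n+[m/n]*n; m%n<n; m%n%n≡m%n)
open import Data.Nat.Divisibility using (_∣_; ∣-antisym; ∣-trans; ∣m+n∣m⇒∣n; ∣1⇒≡1; m∣m*n; n∣m*n)
open import Data.Nat.Coprimality as Coprime using (Coprime; coprime-divisor)
open import Data.Nat.Tactic.RingSolver using (solve-∀)
open import Data.Integer as ℤ using (+_)
import Data.Integer.Tactic.RingSolver as ℤ-Solver
open import Data.Fin as Fin using (Fin; toℕ; fromℕ<)
open import Data.Fin.Properties using (pigeonhole; toℕ-fromℕ<; toℕ<n)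
import Data.Fin.Properties as Finₚ
open import Data.List using (List; []; _∷_; [_]; _++_; length; lookup; applyUpTo; applyDownFrom)
open import Data.List.Properties using (length-++; length-applyUpTo; length-applyDownFrom; ++-assoc)
open import Data.List.Membership.Propositional using (_∈_)
open import Data.List.Membership.Propositional.Properties using (∈-lookup)
open import Data.List.Relation.Unary.Any using (here; there; index)
open import Data.List.Relation.Unary.Any.Properties using (lookup-index)
open import Data.List.Relation.Unary.Linked as Linked using (Linked; []; [-]; _∷_)
open import Data.Product using (_×_; _,_; proj₁; proj₂; ∃; ∃₂)
open import Data.Empty using (⊥-elim)
open import Function using (_∘_)
open import Function.Bundles using (Equivalence)
open import Relation.Binary using (Rel; Transitive; Asymmetric; tri<; tri≈; tri>)
open import Relation.Binary.PropositionalEquality using (_≡_; refl; sym; trans; cong; cong₂; subst; subst₂; module ≡-Reasoning)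
open import Relation.Nullary using (¬_)

m+d≡n⇒m≤n : ∀ {m n} d → m + d ≡ n → m ≤ n
m+d≡n⇒m≤n d refl = m≤m+n _ d

<⇒∃-suc : ∀ {m n} → m < n → ∃ λ s → n ≡ m + suc s
<⇒∃-suc {m} m<n with m≤n⇒∃[o]m+o≡n m<n
... | o , refl = o , sym (+-suc m o)

module StrictlySorted {a r} {A : Set a} {R : Rel A r} (R-trans : Transitive R) (R-asym : Asymmetric R) where

  lookup-mono : ∀ {xs} → Linked R xs → ∀ {i j : Fin (length xs)} →
    i Fin.< j → R (lookup xs i) (lookup xs j)
  lookup-mono {_ ∷ _} xs↗ {Fin.zero} {Fin.suc j} _ =
    Linked.lookup R-trans (Linked.tail xs↗) (Linked.head′ xs↗) j
  lookup-mono {_ ∷ _} xs↗ {Fin.suc i} {Fin.suc j} (s≤s i<j) = lookup-mono (Linked.tail xs↗) i<j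

  lookup-reflects-< : ∀ {xs} → Linked R xs → ∀ {i j : Fin (length xs)} →
    R (lookup xs i) (lookup xs j) → i Fin.< j
  lookup-reflects-< xs↗ {i} {j} Rij with Finₚ.<-cmp i j
  ... | tri< i<j _ _ = i<j
  ... | tri≈ _ refl _ = ⊥-elim (R-asym Rij Rij)
  ... | tri> _ _ j<i = ⊥-elim (R-asym Rij (lookup-mono xs↗ j<i))

  between-∈⇒distance-≤ : ∀ {xs} → Linked R xs → (i j : Fin (length xs)) (L : List A) →
    (∀ p → i Fin.< p → p Fin.< j → lookup xs p ∈ L) → toℕ j ≤ toℕ i + suc (length L)
  between-∈⇒distance-≤ {xs} xs↗ i j L between∈L = ≮⇒≥ too-far
    where
    too-far : ¬ (toℕ i + suc (length L) < toℕ j)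
    too-far far = collision (pigeonhole (n<1+n (length L)) slot)
      where
      offset<j : (p : Fin (suc (length L))) → toℕ i + suc (toℕ p) < toℕ j
      offset<j p = ≤-<-trans (+-monoʳ-≤ (toℕ i) (toℕ<n p)) far

      pos : Fin (suc (length L)) → Fin (length xs)
      pos p = fromℕ< (<-trans (offset<j p) (toℕ<n j))

      toℕ-pos : ∀ p → toℕ (pos p) ≡ toℕ i + suc (toℕ p)
      toℕ-pos p = toℕ-fromℕ< _

      pos∈L : ∀ p → lookup xs (pos p) ∈ L
      pos∈L p = between∈L (pos p)
        (subst (toℕ i <_) (sym (toℕ-pos p)) (m<m+n (toℕ i) z<s))
        (subst (_< toℕ j) (sym (toℕ-pos p)) (offset<j p))

      slot : Fin (suc (length L)) → Fin (length L)
      slot p = index (pos∈L p)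

      collision : ¬ (∃₂ λ p q → p Fin.< q × slot p ≡ slot q)
      collision (p , q , p<q , same-slot) = R-asym Rpq (subst₂ R same (sym same) Rpq)
        where
        same : lookup xs (pos p) ≡ lookup xs (pos q)
        same = trans (lookup-index (pos∈L p))
                     (trans (cong (lookup L) same-slot) (sym (lookup-index (pos∈L q))))
        Rpq : R (lookup xs (pos p)) (lookup xs (pos q))
        Rpq = lookup-mono xs↗ (subst₂ _<_ (sym (toℕ-pos p)) (sym (toℕ-pos q))
                                          (+-monoʳ-< (toℕ i) (s≤s p<q)))

module _ {a r} {A : Set a} {R : Rel A r} where

  linked-applyUpTo : ∀ (f : ℕ → A) n {ys} → (∀ i → R (f i) (f (suc i))) →
    Linked R (f n ∷ ys) → Linked R (applyUpTo f (suc n) ++ ys)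
  linked-applyUpTo f zero    step last = last
  linked-applyUpTo f (suc n) step last = step 0 ∷ linked-applyUpTo (f ∘ suc) n (step ∘ suc) last

  linked-applyDownFrom : ∀ (f : ℕ → A) n {ys} → (∀ i → R (f (suc i)) (f i)) →
    Linked R (f 0 ∷ ys) → Linked R (applyDownFrom f (suc n) ++ ys)
  linked-applyDownFrom f zero    step first = first
  linked-applyDownFrom f (suc n) step first = step n ∷ linked-applyDownFrom f n step first

  linked-ends : ∀ {x} xs {y} → Linked R (x ∷ xs ++ [ y ]) →
    (∃ λ w → R x w) × (∃ λ w → R w y)
  linked-ends []       (Rxy ∷ [-])   = (_ , Rxy) , (_ , Rxy)
  linked-ends (w ∷ xs) (Rxw ∷ chain) = (w , Rxw) , proj₂ (linked-ends xs chain)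

good⇒<-distance : ∀ {F m} → GoodUpTo F m → ∀ k l →
  ¬ SimilarlyOrdered (lookup F k) (lookup F l) → m < ∣ toℕ l - toℕ k ∣
good⇒<-distance good k l ¬similar = ≰⇒> (¬similar ∘ good k l)

-- _<F_ is transitive only when the smaller fraction has a positive denominator.
_<⁺_ : Frac → Frac → Set
x <⁺ y = 1 ≤ proj₂ x × x <F y

<⁺-trans : Transitive _<⁺_
<⁺-trans {a , b} {c , d} {e , f} (1≤b , ad<cb) (_ , cf<ed) =
  1≤b , *-cancelʳ-< d (a * f) (e * b) (begin-strict
    a * f * d  ≡⟨ swap a f d ⟩
    a * d * f  ≤⟨ *-monoˡ-≤ f (<⇒≤ ad<cb) ⟩
    c * b * f  ≡⟨ swap c b f ⟩
    c * f * b  <⟨ *-monoˡ-< b {{>-nonZero 1≤b}} cf<ed ⟩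
    e * d * b  ≡⟨ swap e d b ⟩
    e * b * d  ∎)
  where
  open ≤-Reasoning
  swap : ∀ x y z → x * y * z ≡ x * z * y
  swap = solve-∀

<⁺-asym : Asymmetric _<⁺_
<⁺-asym {_ , _} {_ , _} (_ , x<y) (_ , y<x) = <-asym x<y y<x

linked-<⁺ : ∀ {F} → (∀ {x} → x ∈ F → 1 ≤ proj₂ x) → Linked _<F_ F → Linked _<⁺_ F
linked-<⁺ pos []         = []
linked-<⁺ pos [-]        = [-]
linked-<⁺ pos (x<y ∷ F↗) = (pos (here refl) , x<y) ∷ linked-<⁺ (pos ∘ there) F↗

crossing-<F : ∀ a b → (a , suc b) <F (suc a , b)
crossing-<F a b = *-mono-< (n<1+n a) (n<1+n b)

crossing-¬similar : ∀ a b → ¬ SimilarlyOrdered (a , suc b) (suc a , b)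
crossing-¬similar a b similar = 0≰-1 (subst (+ 0 ℤ.≤_) (product (+ a) (+ b)) similar)
  where
  product : ∀ x y → ((ℤ.1ℤ ℤ.+ x) ℤ.- x) ℤ.* (y ℤ.- (ℤ.1ℤ ℤ.+ y)) ≡ ℤ.-1ℤ
  product = ℤ-Solver.solve-∀
  0≰-1 : ¬ (+ 0 ℤ.≤ ℤ.-1ℤ)
  0≰-1 ()

reduced-≡ : ∀ {a b c d} .{{_ : NonZero b}} → Coprime a b → Coprime c d →
  a * d ≡ c * b → (a , b) ≡ (c , d)
reduced-≡ {a} {b} {c} {d} a⊥b c⊥d ad≡cb = cong₂ _,_ a≡c b≡d
  where
  b≡d : b ≡ d
  b≡d = ∣-antisym
    (coprime-divisor (Coprime.sym a⊥b) (subst (b ∣_) (sym ad≡cb) (n∣m*n c)))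
    (coprime-divisor (Coprime.sym c⊥d) (subst (d ∣_) ad≡cb (n∣m*n a)))
  a≡c : a ≡ c
  a≡c = *-cancelʳ-≡ a c b (subst (λ e → a * e ≡ c * b) (sym b≡d) ad≡cb)

-- p/q, p'/q' are neighbours in the Farey sequence of order N (classical characterisation).
Adjacent : ℕ → Frac → Frac → Set
Adjacent N (p , q) (p' , q') = p' * q ≡ p * q' + 1 × N < q + q'

unimodular⇒coprimeˡ : ∀ {p q p' q'} → p' * q ≡ p * q' + 1 → Coprime p q
unimodular⇒coprimeˡ {p} {q} {p'} {q'} det {d} (d∣p , d∣q) = ∣1⇒≡1
  (∣m+n∣m⇒∣n (subst (d ∣_) det (∣-trans d∣q (n∣m*n p'))) (∣-trans d∣p (m∣m*n q')))

unimodular⇒coprimeʳ : ∀ {p q p' q'} → p' * q ≡ p * q' + 1 → Coprime p' q'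
unimodular⇒coprimeʳ {p} {q} {p'} {q'} det {d} (d∣p' , d∣q') = ∣1⇒≡1
  (∣m+n∣m⇒∣n (subst (d ∣_) det (∣-trans d∣p' (m∣m*n q))) (∣-trans d∣q' (n∣m*n p)))

-- Cramer's rule: a/b = (s p' + t p)/(s q' + t q) for the unimodular pair p/q, p'/q'.
between-denominator : ∀ {p q p' q' a b s t} → p' * q ≡ p * q' + 1 →
  a * q ≡ p * b + s → p' * b ≡ a * q' + t → b ≡ q' * s + q * t
between-denominator {p} {q} {p'} {q'} {a} {b} {s} {t} det left right =
  +-cancelˡ-≡ (p * q' * b) b (q' * s + q * t) (begin
    p * q' * b + b                 ≡⟨ e₁ p q' b ⟩
    (p * q' + 1) * b               ≡⟨ cong (_* b) det ⟨
    p' * q * b                     ≡⟨ e₂ p' q b ⟩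
    q * (p' * b)                   ≡⟨ cong (q *_) right ⟩
    q * (a * q' + t)               ≡⟨ e₃ q a q' t ⟩
    q' * (a * q) + q * t           ≡⟨ cong (λ e → q' * e + q * t) left ⟩
    q' * (p * b + s) + q * t       ≡⟨ e₄ q' p b s q t ⟩
    p * q' * b + (q' * s + q * t)  ∎)
  where
  open ≡-Reasoning
  e₁ : ∀ x y z → x * y * z + z ≡ (x * y + 1) * z
  e₁ = solve-∀
  e₂ : ∀ x y z → x * y * z ≡ y * (x * z)
  e₂ = solve-∀
  e₃ : ∀ x y z w → x * (y * z + w) ≡ z * (y * x) + x * w
  e₃ = solve-∀
  e₄ : ∀ x y z w u v → x * (y * z + w) + u * v ≡ y * x * z + (x * w + u * v)
  e₄ = solve-∀

adjacent-gap : ∀ {N x y z} → Adjacent N x y → x <F z → z <F y → N < proj₂ z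
adjacent-gap {N} {p , q} {p' , q'} {a , b} (det , N<q+q') x<z z<y
  with s , left ← <⇒∃-suc x<z | t , right ← <⇒∃-suc z<y = begin-strict
    N                          <⟨ N<q+q' ⟩
    q + q'                     ≡⟨ +-comm q q' ⟩
    q' + q                     ≤⟨ +-mono-≤ (m≤m*n q' (suc s)) (m≤m*n q (suc t)) ⟩
    q' * suc s + q * suc t     ≡⟨ between-denominator {p} {q} {p'} {q'} {a} {b} det left right ⟨
    b                          ∎
  where open ≤-Reasoning

chain-covers : ∀ {N x y z} cs → Linked (Adjacent N) (x ∷ cs ++ [ y ]) →
  InFarey N z → x <F z → z <F y → z ∈ cs
chain-covers {x = x} {y} {z} [] (x~y ∷ [-]) (_ , _ , _ , b≤N) x<z z<y =
  ⊥-elim (<⇒≱ (adjacent-gap {x = x} {y} {z} x~y x<z z<y) b≤N)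
chain-covers {x = p , q} {z = a , b} ((c , d) ∷ cs) (x~c ∷ chain) z∈F@(a⊥b , _ , 1≤b , b≤N) x<z z<y
  with <-cmp (a * d) (c * b)
... | tri< z<c _ _ = ⊥-elim (<⇒≱ (adjacent-gap {x = p , q} {c , d} {a , b} x~c x<z z<c) b≤N)
... | tri≈ _ z≈c _ = here (reduced-≡ {{>-nonZero 1≤b}} a⊥b (unimodular⇒coprimeʳ {p} {q} (proj₁ x~c)) z≈c)
... | tri> _ _ c<z = there (chain-covers cs chain z∈F c<z z<y)

good≤-between : ∀ {n F m} x y → IsFareySeq n F → InFarey n x → InFarey n y → x <F y →
  ¬ SimilarlyOrdered x y → (L : List Frac) →
  (∀ {z} → InFarey n z → x <F z → z <F y → z ∈ L) → GoodUpTo F m → m ≤ length L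
good≤-between {n} {F} {m} x y (F↗ , F⇔) x∈Fₙ y∈Fₙ x<y ¬similar L between∈L good =
  s≤s⁻¹ (begin-strict
    m                   <⟨ good⇒<-distance {F} good i j (subst₂ (λ u v → ¬ SimilarlyOrdered u v) x≡ y≡ ¬similar) ⟩
    ∣ toℕ j - toℕ i ∣   ≡⟨ m≤n⇒∣n-m∣≡n∸m (<⇒≤ i<j) ⟩
    toℕ j ∸ toℕ i       ≤⟨ m≤n+o⇒m∸n≤o (toℕ j) (toℕ i) (between-∈⇒distance-≤ F⁺ i j L between-i-j∈L) ⟩
    suc (length L)      ∎)
  where
  open ≤-Reasoning
  open Equivalence

  F⁺ : Linked _<⁺_ F
  F⁺ = linked-<⁺ (λ z∈F → proj₁ (proj₂ (proj₂ (to (F⇔ _) z∈F)))) F↗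

  -- the arguments are explicit because _<F_ is not injective
  open StrictlySorted (λ {x y z} → <⁺-trans {x} {y} {z}) (λ {x y} → <⁺-asym {x} {y})

  i j : Fin (length F)
  i = index (from (F⇔ x) x∈Fₙ)
  j = index (from (F⇔ y) y∈Fₙ)

  x≡ : x ≡ lookup F i
  x≡ = lookup-index (from (F⇔ x) x∈Fₙ)

  y≡ : y ≡ lookup F j
  y≡ = lookup-index (from (F⇔ y) y∈Fₙ)

  i<j : i Fin.< j
  i<j = lookup-reflects-< F⁺ (subst₂ _<⁺_ x≡ y≡ (proj₁ (proj₂ (proj₂ x∈Fₙ)) , x<y))

  between-i-j∈L : ∀ p → i Fin.< p → p Fin.< j → lookup F p ∈ L
  between-i-j∈L p i<p p<j = between∈L (to (F⇔ _) (∈-lookup p))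
    (subst (_<F lookup F p) (sym x≡) (proj₂ (lookup-mono F⁺ i<p)))
    (subst (lookup F p <F_) (sym y≡) (proj₂ (lookup-mono F⁺ p<j)))

good≤-crossing-chain : ∀ {n F m} a b → IsFareySeq n F → a < b → suc b ≤ n → (L : List Frac) →
  Linked (Adjacent n) ((a , suc b) ∷ L ++ [ (suc a , b) ]) → GoodUpTo F m → m ≤ length L
good≤-crossing-chain a b F-farey a<b b<n L chain =
  good≤-between (a , suc b) (suc a , b) F-farey x∈Fₙ y∈Fₙ (crossing-<F a b) (crossing-¬similar a b) L
    (chain-covers L chain)
  where
  x∈Fₙ : InFarey _ (a , suc b)
  x∈Fₙ with (c , d) , x~w ← proj₁ (linked-ends L chain) =
    unimodular⇒coprimeˡ {p' = c} {d} (proj₁ x~w) , ≤-trans (<⇒≤ a<b) (n≤1+n b) , z<s , b<n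

  y∈Fₙ : InFarey _ (suc a , b)
  y∈Fₙ with (c , d) , w~y ← proj₂ (linked-ends L chain) =
    unimodular⇒coprimeʳ {c} {d} (proj₁ w~y) , a<b , <-≤-trans z<s a<b , <⇒≤ b<n

half : Frac
half = 1 , 2

below½ above½ : ℕ → Frac
below½ m = m , 2 * m + 1
above½ m = suc m , 2 * m + 1

below½-adjacent : ∀ {N} m → N < 4 * m + 4 → Adjacent N (below½ m) (below½ (suc m))
below½-adjacent {N} m N< = det m , subst (N <_) (sum m) N<
  where
  det : ∀ m → suc m * (2 * m + 1) ≡ m * (2 * suc m + 1) + 1
  det = solve-∀
  sum : ∀ m → 4 * m + 4 ≡ 2 * m + 1 + (2 * suc m + 1)
  sum = solve-∀

above½-adjacent : ∀ {N} m → N < 4 * m + 4 → Adjacent N (above½ (suc m)) (above½ m)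
above½-adjacent {N} m N< = det m , subst (N <_) (sum m) N<
  where
  det : ∀ m → suc m * (2 * suc m + 1) ≡ suc (suc m) * (2 * m + 1) + 1
  det = solve-∀
  sum : ∀ m → 4 * m + 4 ≡ 2 * suc m + 1 + (2 * m + 1)
  sum = solve-∀

below½-adjacent-half : ∀ {N} m → N < 2 * m + 3 → Adjacent N (below½ m) half
below½-adjacent-half {N} m N< = det m , subst (N <_) (sum m) N<
  where
  det : ∀ m → 1 * (2 * m + 1) ≡ m * 2 + 1
  det = solve-∀
  sum : ∀ m → 2 * m + 3 ≡ 2 * m + 1 + 2
  sum = solve-∀

half-adjacent-above½ : ∀ {N} m → N < 2 * m + 3 → Adjacent N half (above½ m)
half-adjacent-above½ {N} m N< = det m , subst (N <_) (sum m) N<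
  where
  det : ∀ m → suc m * 2 ≡ 1 * (2 * m + 1) + 1
  det = solve-∀
  sum : ∀ m → 2 * m + 3 ≡ 2 + (2 * m + 1)
  sum = solve-∀

below½-run : ∀ {N} k ℓ {ys} → N < 4 * k + 4 → Linked (Adjacent N) (below½ (ℓ + k) ∷ ys) →
  Linked (Adjacent N) (applyUpTo (λ i → below½ (i + k)) (suc ℓ) ++ ys)
below½-run k ℓ N< = linked-applyUpTo (λ i → below½ (i + k)) ℓ λ i →
  below½-adjacent (i + k) (<-≤-trans N< (+-monoˡ-≤ 4 (*-monoʳ-≤ 4 (m≤n+m k i))))

above½-run : ∀ {N} k ℓ {ys} → N < 4 * k + 4 → Linked (Adjacent N) (above½ k ∷ ys) →
  Linked (Adjacent N) (applyDownFrom (λ i → above½ (i + k)) (suc ℓ) ++ ys)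
above½-run k ℓ N< = linked-applyDownFrom (λ i → above½ (i + k)) ℓ λ i →
  above½-adjacent (i + k) (<-≤-trans N< (+-monoˡ-≤ 4 (*-monoʳ-≤ 4 (m≤n+m k i))))

good≤-order-4k : ∀ j {F m} → IsFareySeq (suc j * 4) F → GoodUpTo F m → m ≤ suc j + 1
good≤-order-4k j {m = m} F-farey good =
  subst (m ≤_) |L| (good≤-crossing-chain (1 + 2 * j) (3 + j * 4) F-farey a<b ≤-refl L chain good)
  where
  k : ℕ
  k = suc j

  run L : List Frac
  run = applyUpTo (λ i → below½ (i + k)) k
  L = run ++ [ half ]

  |L| : length L ≡ k + 1
  |L| = trans (length-++ run) (cong (_+ 1) (length-applyUpTo (λ i → below½ (i + k)) k))

  a<b : 1 + 2 * j < 3 + j * 4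
  a<b = m+d≡n⇒m≤n (1 + 2 * j) (e₁ j)
    where
    e₁ : ∀ j → 2 + 2 * j + (1 + 2 * j) ≡ 3 + j * 4
    e₁ = solve-∀

  x~k : Adjacent (k * 4) (1 + 2 * j , 4 + j * 4) (below½ k)
  x~k = det j , m<m+n _ z<s
    where
    det : ∀ j → suc j * (4 + j * 4) ≡ (1 + 2 * j) * (2 * suc j + 1) + 1
    det = solve-∀

  N<4k+4 : k * 4 < 4 * k + 4
  N<4k+4 = m+d≡n⇒m≤n 3 (e₂ j)
    where
    e₂ : ∀ j → 5 + j * 4 + 3 ≡ 4 * suc j + 4
    e₂ = solve-∀

  N<½ : k * 4 < 2 * (j + k) + 3
  N<½ = m+d≡n⇒m≤n 0 (e₃ j)
    where
    e₃ : ∀ j → 5 + j * 4 + 0 ≡ 2 * (j + suc j) + 3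
    e₃ = solve-∀

  half~y : Adjacent (k * 4) half (2 + 2 * j , 3 + j * 4)
  half~y = det j , ≤-refl
    where
    det : ∀ j → (2 + 2 * j) * 2 ≡ 1 * (3 + j * 4) + 1
    det = solve-∀

  chain : Linked (Adjacent (k * 4)) ((1 + 2 * j , 4 + j * 4) ∷ L ++ [ (2 + 2 * j , 3 + j * 4) ])
  chain = subst (λ l → Linked (Adjacent (k * 4)) ((1 + 2 * j , 4 + j * 4) ∷ l))
    (sym (++-assoc run [ half ] _))
    (x~k ∷ below½-run k j N<4k+4 (below½-adjacent-half (j + k) N<½ ∷ half~y ∷ [-]))

2*k<k*4 : ∀ {k} → 1 ≤ k → 2 * k < k * 4
2*k<k*4 {k} 1≤k = subst (2 * k <_) (e k) (m<m+n (2 * k) (≤-trans z<s (*-monoʳ-≤ 2 1≤k)))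
  where
  e : ∀ k → 2 * k + 2 * k ≡ k * 4
  e = solve-∀

above½-chain : ∀ k r d → r ≤ 3 → r ≤ 2 * k → r < 2 * d + 3 →
  Linked (Adjacent (r + k * 4))
    (half ∷ applyDownFrom (λ i → above½ (i + k)) (suc (d + k)) ++ [ (suc (2 * k) , k * 4) ])
above½-chain k r d r≤3 r≤2k r<2d+3 =
  half-adjacent-above½ (d + k + k) N<½ ∷ above½-run k (d + k) N<4k+4 (last ∷ [-])
  where
  N<½ : r + k * 4 < 2 * (d + k + k) + 3
  N<½ = subst (r + k * 4 <_) (e₁ k d) (+-monoˡ-< (k * 4) r<2d+3)
    where
    e₁ : ∀ k d → 2 * d + 3 + k * 4 ≡ 2 * (d + k + k) + 3
    e₁ = solve-∀

  N<4k+4 : r + k * 4 < 4 * k + 4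
  N<4k+4 = subst (r + k * 4 <_) (e₂ k) (s≤s (+-monoˡ-≤ (k * 4) r≤3))
    where
    e₂ : ∀ k → 4 + k * 4 ≡ 4 * k + 4
    e₂ = solve-∀

  last : Adjacent (r + k * 4) (above½ k) (suc (2 * k) , k * 4)
  last = det k , subst (r + k * 4 <_) (e₃ k) (s≤s (+-monoˡ-≤ (k * 4) r≤2k))
    where
    det : ∀ k → suc (2 * k) * (2 * k + 1) ≡ suc k * (k * 4) + 1
    det = solve-∀
    e₃ : ∀ k → suc (2 * k + k * 4) ≡ 2 * k + 1 + k * 4
    e₃ = solve-∀

good≤-order-4k+r : ∀ k r {F m} → 1 ≤ k → 1 ≤ r → r ≤ 2 → IsFareySeq (r + k * 4) F →
  GoodUpTo F m → m ≤ k + 2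
good≤-order-4k+r k r {m = m} 1≤k 1≤r r≤2 F-farey good = subst (m ≤_) |L|
  (good≤-crossing-chain (2 * k) (k * 4) F-farey (2*k<k*4 1≤k) (+-monoˡ-≤ (k * 4) 1≤r) L chain good)
  where
  L : List Frac
  L = half ∷ applyDownFrom (λ i → above½ (i + k)) (suc k)

  |L| : length L ≡ k + 2
  |L| = trans (cong suc (length-applyDownFrom (λ i → above½ (i + k)) (suc k))) (+-comm 2 k)

  x~half : Adjacent (r + k * 4) (2 * k , suc (k * 4)) half
  x~half = det k , subst (r + k * 4 <_) (e k) (s≤s (+-monoˡ-≤ (k * 4) r≤2))
    where
    det : ∀ k → 1 * suc (k * 4) ≡ 2 * k * 2 + 1
    det = solve-∀
    e : ∀ k → 3 + k * 4 ≡ suc (k * 4) + 2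
    e = solve-∀

  chain : Linked (Adjacent (r + k * 4)) ((2 * k , suc (k * 4)) ∷ L ++ [ (suc (2 * k) , k * 4) ])
  chain = x~half ∷ above½-chain k r 0 (≤-trans r≤2 (n≤1+n 2)) (≤-trans r≤2 (*-monoʳ-≤ 2 1≤k)) (s≤s r≤2)

good≤-order-4k+3 : ∀ k {F m} → 2 ≤ k → IsFareySeq (3 + k * 4) F → GoodUpTo F m → m ≤ k + 4
good≤-order-4k+3 k {m = m} 2≤k F-farey good = subst (m ≤_) |L|
  (good≤-crossing-chain (2 * k) (k * 4) F-farey (2*k<k*4 (<⇒≤ 2≤k)) (+-monoˡ-≤ (k * 4) z<s) L chain good)
  where
  L : List Frac
  L = below½ (suc (2 * k)) ∷ half ∷ applyDownFrom (λ i → above½ (i + k)) (suc (suc k))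

  |L| : length L ≡ k + 4
  |L| = trans (cong (suc ∘ suc) (length-applyDownFrom (λ i → above½ (i + k)) (suc (suc k)))) (+-comm 4 k)

  x~below : Adjacent (3 + k * 4) (2 * k , suc (k * 4)) (below½ (suc (2 * k)))
  x~below = det k , m+d≡n⇒m≤n (4 * k) (e₁ k)
    where
    det : ∀ k → suc (2 * k) * suc (k * 4) ≡ 2 * k * (2 * suc (2 * k) + 1) + 1
    det = solve-∀
    e₁ : ∀ k → 4 + k * 4 + 4 * k ≡ suc (k * 4) + (2 * suc (2 * k) + 1)
    e₁ = solve-∀

  N<½ : 3 + k * 4 < 2 * suc (2 * k) + 3
  N<½ = m+d≡n⇒m≤n 1 (e₂ k)
    where
    e₂ : ∀ k → 4 + k * 4 + 1 ≡ 2 * suc (2 * k) + 3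
    e₂ = solve-∀

  chain : Linked (Adjacent (3 + k * 4)) ((2 * k , suc (k * 4)) ∷ L ++ [ (suc (2 * k) , k * 4) ])
  chain = x~below ∷ below½-adjacent-half (suc (2 * k)) N<½
    ∷ above½-chain k 3 1 ≤-refl (≤-trans (n≤1+n 3) (*-monoʳ-≤ 2 2≤k)) (<ᵇ⇒< 3 5 _)

good≤-order-7 : ∀ {F m} → IsFareySeq 7 F → GoodUpTo F m → m ≤ 5
good≤-order-7 F-farey good = good≤-crossing-chain 4 6 F-farey (<ᵇ⇒< 4 6 _) ≤-refl
  ((3 , 5) ∷ (2 , 3) ∷ (5 , 7) ∷ (3 , 4) ∷ [ (4 , 5) ])
  ((refl , <ᵇ⇒< _ _ _) ∷ (refl , <ᵇ⇒< _ _ _) ∷ (refl , <ᵇ⇒< _ _ _) ∷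
   (refl , <ᵇ⇒< _ _ _) ∷ (refl , <ᵇ⇒< _ _ _) ∷ (refl , <ᵇ⇒< _ _ _) ∷ [-])
  good

good≤-by-residue : ∀ {n F m} k r → n ≡ r + k * 4 → r < 4 → 4 ≤ n → IsFareySeq n F →
  GoodUpTo F m → m ≤ k + dOf r
good≤-by-residue zero r refl r<4 4≤n = ⊥-elim (<⇒≱ r<4 (subst (4 ≤_) (+-identityʳ r) 4≤n))
good≤-by-residue (suc j) 0 refl _ _ = good≤-order-4k j
good≤-by-residue (suc j) 1 refl _ _ = good≤-order-4k+r (suc j) 1 z<s z<s (s≤s z≤n)
good≤-by-residue (suc j) 2 refl _ _ = good≤-order-4k+r (suc j) 2 z<s z<s ≤-refl
good≤-by-residue 1 3 refl _ _ = good≤-order-7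
good≤-by-residue (suc (suc j)) 3 refl _ _ = good≤-order-4k+3 (suc (suc j)) (s≤s z<s)
good≤-by-residue (suc _) (suc (suc (suc (suc _)))) _ (s≤s (s≤s (s≤s (s≤s ())))) _

dOf-%4 : ∀ n → dOf (n % 4) ≡ dOf n
dOf-%4 n rewrite m%n%n≡m%n n 4 {{_}} = refl

theorem1 : (n : ℕ) → 4 ≤ n → (F : List Frac) → IsFareySeq n F →
    (m : ℕ) → IsLargestGood F m → m ≤ n / 4 + dOf n
theorem1 n 4≤n F F-farey m (good , _) = subst (λ d → m ≤ n / 4 + d) (dOf-%4 n)
  (good≤-by-residue (n / 4) (n % 4) (m≡m%n+[m/n]*n n 4) (m%n<n n 4) 4≤n F-farey good)
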